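{- Let $Q$ be a finite set, let $S,S'$ be nonempty sets and $f:S'\to S$ a surjective map such that $f^{ -1}(s)$ is infinite for every $s\in S$. Then for every first-order $Q$-constraint $\theta$: (1) for every one-step interpretation $(S,I)$ over $Q$, $(S,I)\models\mathrm{BI}(\theta)$ iff $(S',I_f)\models\theta$; (2) for every one-step interpretation $(S,I)$ over $Q$, $(S,I)\models\widetilde{\mathrm{BI}(\theta)}$ iff $(S',I_f)\models\widetilde{\theta}$; (3) for every one-step interpretation $(S',I')$ over $Q$, if $(S',I')\models\theta$ then $(S,(I')_{f^{ -1}})\models\mathrm{BI}(\theta)$; (4) for every one-step interpretation $(S',I')$ over $Q$, if $(S',I')\models\widetilde{\theta}$ then $(S,(I')_{f^{ -1}})\models\widetilde{\mathrm{BI}(\theta)}$.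
   Context: A one-step interpretation over $Q$ is $(S,I)$ with $S$ nonempty and $I:S\to2^Q$. First-order $Q$-constraints: sentences of $\theta::=\top\mid\bot\mid q(x)\mid x=y\mid x\neq y\mid\theta\vee\theta\mid\theta\wedge\theta\mid\exists x.\theta\mid\forall x.\theta$ ($q\in Q$), interpreted over $S$ with $q(x)$ true iff $q\in I(x)$; a constraint is symmetric if it contains no $=$ or $\neq$. The dual $\tilde\theta$ exchanges $\vee$ with $\wedge$, $\top$ with $\bot$, $x=y$ with $x\ne y$, and $\exists$ with $\forall$. For $f:S'\to S$: $I_f(s')=I(f(s'))$, and $(I')_{f^{ -1}}(s)=\bigcup_{s'\in f^{ -1}(s)}I'(s')$. A $Q$-type is $A\subseteq Q$, $t(A)(x)=\bigwedge_{q\in A}q(x)$ ($\top$ if empty). For sets of types $T_\exists=\{A_1,\dots,A_n\}$, $T_\forall$: the basic formula $\theta^{=}(T_\exists,T_\forall)=\exists x_1\dots\exists x_n.(\mathrm{diff}(x_1,\dots,x_n)\wedge\bigwedge_it(A_i)(x_i)\wedge\forall y.(\mathrm{diff}(x_1,\dots,x_n,y)\to\bigvee_{B\in T_\forall}t(B)(y)))$ ($\mathrm{diff}$ = pairwise distinct), and the symmetric basic formula $\theta(T_\exists,T_\forall)=\exists x_1\dots\exists x_n.(\bigwedge_it(A_i)(x_i)\wedge\forall y.\bigvee_{B\in T_\forall}t(B)(y))$. Every first-order $Q$-constraint is effectively equivalent to a disjunction of basic formulas. $\mathrm{BI}(\theta)$ is defined as: $\theta(T_\exists,T_\forall)$ if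 $\theta=\theta^{=}(T_\exists,T_\forall)$; $\bigvee_j\mathrm{BI}(\theta_j)$ if $\theta$ is a disjunction $\bigvee_j\theta_j$ of basic formulas; otherwise $\bigvee_j\mathrm{BI}(\theta_j)$ for a fixed effectively computed disjunction $\bigvee_j\theta_j$ of basic formulas equivalent to $\theta$. -}

module Defs where

open import Level using (0ℓ)
open import Data.Nat using (ℕ; zero; suc)
open import Data.Fin using (Fin; zero; suc)
open import Data.Fin.Subset using (Subset)
open import Data.Bool using (Bool; true; false)
open import Data.Vec using (Vec; []; _∷_)
open import Data.List using (List; []; _∷_; length; lookup; allFin; map; foldr)
open import Data.Product using (Σ; ∃; _×_; _,_)
open import Data.Sum using (_⊎_)
open import Data.Unit using (⊤)
open import Data.Empty using (⊥)
open import Relation.Binary.PropositionalEquality using (_≡_)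
open import Relation.Nullary using (¬_)
open import Function.Bundles using (_⇔_; _↔_)

-- The finite set Q of propositions is Fin k.
-- First-order Q-constraints, with de Bruijn variables: Fm k n is a
-- formula with (at most) n free variables; sentences are Fm k 0.

data Fm (k : ℕ) (n : ℕ) : Set where
  tt ff     : Fm k n
  atom      : Fin k → Fin n → Fm k n
  eq neq    : Fin n → Fin n → Fm k n
  or and    : Fm k n → Fm k n → Fm k n
  ex all    : Fm k (suc n) → Fm k n

Sentence : ℕ → Set
Sentence k = Fm k 0

dual : ∀ {k n} → Fm k n → Fm k n
dual tt = ff
dual ff = tt
dual (atom q x) = atom q x
dual (eq x y) = neq x y
dual (neq x y) = eq x y
dual (or φ ψ) = and (dual φ) (dual ψ)
dual (and φ ψ) = or (dual φ) (dual ψ)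
dual (ex φ) = all (dual φ)
dual (all φ) = ex (dual φ)

-- One-step interpretations (S , I) with I : S → 2^Q, where a subset of
-- Q is represented as a predicate on Q (q ∈ I s  iff  I s q inhabited).

Interp : ℕ → Set → Set₁
Interp k S = S → Fin k → Set

Sat : ∀ {k n} (S : Set) → Interp k S → Fm k n → (Fin n → S) → Set
Sat S I tt ρ = ⊤
Sat S I ff ρ = ⊥
Sat S I (atom q x) ρ = I (ρ x) q
Sat S I (eq x y) ρ = ρ x ≡ ρ y
Sat S I (neq x y) ρ = ¬ (ρ x ≡ ρ y)
Sat S I (or φ ψ) ρ = Sat S I φ ρ ⊎ Sat S I ψ ρ
Sat S I (and φ ψ) ρ = Sat S I φ ρ × Sat S I ψ ρ
Sat S I (ex φ) ρ = Σ S λ s → Sat S I φ (extend s ρ)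
  where
  extend : ∀ {n} → S → (Fin n → S) → Fin (suc n) → S
  extend s ρ zero = s
  extend s ρ (suc i) = ρ i
Sat S I (all φ) ρ = (s : S) → Sat S I φ (extend s ρ)
  where
  extend : ∀ {n} → S → (Fin n → S) → Fin (suc n) → S
  extend s ρ zero = s
  extend s ρ (suc i) = ρ i

Models : ∀ {k} (S : Set) → Interp k S → Sentence k → Set
Models S I θ = Sat S I θ (λ ())

pullback : ∀ {k} {S S' : Set} → (S' → S) → Interp k S → Interp k S'
pullback f I s' = I (f s')

pushforward : ∀ {k} {S S' : Set} → (S' → S) → Interp k S' → Interp k S
pushforward {S' = S'} f I' s q = Σ S' λ s' → f s' ≡ s × I' s' q

Finite : Set → Set
Finite X = ∃ λ (n : ℕ) → X ↔ Fin n

Infinite : Set → Set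
Infinite X = ¬ Finite X

Fibre : {S S' : Set} → (S' → S) → S → Set
Fibre {S' = S'} f s = Σ S' λ s' → f s' ≡ s

Surjective : {S S' : Set} → (S' → S) → Set
Surjective {S} {S'} f = (s : S) → Σ S' λ s' → f s' ≡ s

QType : ℕ → Set
QType k = Subset k

⋀ ⋁ : ∀ {k n} → List (Fm k n) → Fm k n
⋀ = foldr and tt
⋁ = foldr or ff

tyAux : ∀ {k m n} → (Fin m → Fin k) → Vec Bool m → Fin n → Fm k n
tyAux emb [] x = tt
tyAux emb (true ∷ A) x = and (atom (emb zero) x) (tyAux (λ i → emb (suc i)) A x)
tyAux emb (false ∷ A) x = tyAux (λ i → emb (suc i)) A x

ty : ∀ {k n} → QType k → Fin n → Fm k n
ty A x = tyAux (λ q → q) A x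

diff : ∀ {k n} → List (Fin n) → Fm k n
diff [] = tt
diff (v ∷ vs) = and (⋀ (map (neq v) vs)) (diff vs)

exN : ∀ {k} (m : ℕ) → Fm k m → Fm k 0
exN zero φ = φ
exN (suc m) φ = exN m (ex φ)

xs : ∀ {k} → (Te : List (QType k)) → List (Fin (length Te))
xs Te = allFin (length Te)

typesOf : ∀ {k} (Te : List (QType k)) → Fm k (length Te)
typesOf Te = ⋀ (map (λ i → ty (lookup Te i) i) (allFin (length Te)))

forallTypes : ∀ {k n} → List (QType k) → Fm k (suc n)
forallTypes Ta = ⋁ (map (λ B → ty B zero) Ta)

-- θ^=(T∃,T∀); the implication P → φ is written (dual P) ∨ φ, since the
-- grammar has no →/¬ and diff is a conjunction of ≠-literals.
basicEq : ∀ {k} → List (QType k) → List (QType k) → Sentence k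
basicEq Te Ta =
  exN (length Te)
    (and (diff (xs Te))
    (and (typesOf Te)
         (all (or (dual (diff (map suc (xs Te) Data.List.++ (zero ∷ []))))
                  (forallTypes Ta)))))

basicSym : ∀ {k} → List (QType k) → List (QType k) → Sentence k
basicSym Te Ta = exN (length Te) (and (typesOf Te) (all (forallTypes Ta)))

-- BI depends on the chosen (effectively computed) disjunction
-- ⋁_j θ^=(T∃ʲ,T∀ʲ) of basic formulas equivalent to θ; such a choice is
-- recorded as a NormalForm of θ.  (For θ itself basic, or a disjunction
-- of basic formulas, the paper's choice is that formula itself.)

BasicData : ℕ → Set
BasicData k = List (QType k) × List (QType k)

Equivalent : ∀ {k} → Sentence k → Sentence k → Set₁
Equivalent {k} θ ψ =
  (S : Set) → S → (I : Interp k S) → Models S I θ ⇔ Models S I ψ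

record NormalForm {k : ℕ} (θ : Sentence k) : Set₁ where
  field
    disjuncts   : List (BasicData k)
    equivalence : Equivalent θ (⋁ (map (λ { (Te , Ta) → basicEq Te Ta }) disjuncts))

BI : ∀ {k} {θ : Sentence k} → NormalForm θ → Sentence k
BI N = ⋁ (map (λ { (Te , Ta) → basicSym Te Ta }) (NormalForm.disjuncts N))

-- Lifting a valuation of S along f to pairwise distinct points of S' is possible because every
-- fibre is infinite, so in (S', I_f) the symmetric basic formula θ(T∃,T∀) gains the diff-conjunct
-- of θ^=(T∃,T∀) for free; conversely, the ∀-part of θ^= only exempts the finitely many witnesses,
-- and each point of S has a preimage outside them. Hence (S, I) ⊨ θ(T∃,T∀) iff (S', I_f) ⊨ θ^=(T∃,T∀),
-- which with the normal form gives (1). Every formula is monotone in the interpretation, and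
-- I' ⊆ ((I')_{f⁻¹})_f, which gives (3). Classically (S, I) ⊨ dual φ iff (S, ∁I) ⊭ φ, and taking
-- complements commutes with pulling back, which turns (1) and (3) into (2) and (4).
module Submission where

open import Defs
open import Axiom.ExcludedMiddle using (ExcludedMiddle)
open import Axiom.DoubleNegationElimination using (em⇒dne)
open import Level using (0ℓ)
open import Data.Nat using (ℕ; zero; suc)
open import Data.Fin using (Fin; zero; suc)
open import Data.Bool using (Bool; true; false)
open import Data.Vec using (Vec; []; _∷_)
open import Data.List using (List; []; _∷_; map; _++_; length; lookup; allFin; tabulate; deduplicate)
open import Data.List.Relation.Unary.All using (All; []; _∷_)
import Data.List.Relation.Unary.All as All
import Data.List.Relation.Unary.All.Properties as All
open import Data.List.Relation.Unary.Any using (here; there; index)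
open import Data.List.Relation.Unary.Any.Properties using (lookup-index)
open import Data.List.Relation.Unary.AllPairs using (AllPairs; []; _∷_)
import Data.List.Relation.Unary.AllPairs as AllPairs
import Data.List.Relation.Unary.AllPairs.Properties as AllPairs
open import Data.List.Relation.Unary.Unique.Propositional.Properties using (allFin⁺)
open import Data.List.Relation.Unary.Unique.DecPropositional.Properties using (deduplicate-!)
open import Data.List.Membership.Propositional using (_∈_)
open import Data.List.Membership.Propositional.Properties using (∈-lookup; ∈-tabulate⁺; ∈-deduplicate⁺)
open import Data.List.Membership.Propositional.Properties.WithK using (unique⇒irrelevant)
open import Data.Product using (Σ; ∃; _×_; _,_)
open import Data.Product.Function.NonDependent.Propositional using (_×-⇔_)
open import Data.Sum using (_⊎_; inj₁; inj₂; [_,_])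
open import Data.Sum.Function.Propositional using (_⊎-⇔_)
open import Data.Empty using (⊥-elim)
open import Function using (_∘_; _on_; id)
open import Function.Bundles using (_⇔_; mk⇔; mk↔ₛ′; Equivalence)
import Function.Properties.Equivalence as ⇔
open import Function.Related.TypeIsomorphisms using (¬-cong-⇔)
open import Function.Definitions using (Injective)
open import Relation.Nullary using (¬_; yes; no)
open import Relation.Unary using (∁; _⊆_)
open import Relation.Binary.Definitions using (DecidableEquality)
open import Relation.Binary.PropositionalEquality using (_≡_; _≢_; _≗_; refl; sym; trans; cong; subst)
open import Relation.Binary.PropositionalEquality.WithK using (≡-irrelevant)

open Equivalence using (to; from)

private variable
  k m n : ℕ
  S S' X : Set

extend : S → (Fin n → S) → Fin (suc n) → S
extend s ρ zero    = s
extend s ρ (suc i) = ρ i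

∁ᴵ : Interp k S → Interp k S
∁ᴵ I s = ∁ (I s)

-- Sat extends valuations with two private copies of extend (one per quantifier); the pattern
-- lambdas λ { zero → … ; (suc i) → … } below convert between them pointwise.
Sat-resp-≗ : {I : Interp k S} (φ : Fm k n) {ρ ρ' : Fin n → S} → ρ ≗ ρ' → Sat S I φ ρ → Sat S I φ ρ'
Sat-resp-≗ tt e h = h
Sat-resp-≗ {I = I} (atom q x) e h = subst (λ s → I s q) (e x) h
Sat-resp-≗ (eq x y) e h = trans (sym (e x)) (trans h (e y))
Sat-resp-≗ (neq x y) e h = λ p → h (trans (e x) (trans p (sym (e y))))
Sat-resp-≗ (or φ ψ) e (inj₁ h) = inj₁ (Sat-resp-≗ φ e h)
Sat-resp-≗ (or φ ψ) e (inj₂ h) = inj₂ (Sat-resp-≗ ψ e h)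
Sat-resp-≗ (and φ ψ) e (h₁ , h₂) = Sat-resp-≗ φ e h₁ , Sat-resp-≗ ψ e h₂
Sat-resp-≗ (ex φ) e (s , h) = s , Sat-resp-≗ φ (λ { zero → refl ; (suc i) → e i }) h
Sat-resp-≗ (all φ) e h = λ s → Sat-resp-≗ φ (λ { zero → refl ; (suc i) → e i }) (h s)

Sat-mono : {I J : Interp k S} → (∀ s → I s ⊆ J s) → (φ : Fm k n) {ρ : Fin n → S} →
           Sat S I φ ρ → Sat S J φ ρ
Sat-mono I⊆J tt h = h
Sat-mono I⊆J (atom q x) {ρ} h = I⊆J (ρ x) h
Sat-mono I⊆J (eq x y) h = h
Sat-mono I⊆J (neq x y) h = h
Sat-mono I⊆J (or φ ψ) (inj₁ h) = inj₁ (Sat-mono I⊆J φ h)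
Sat-mono I⊆J (or φ ψ) (inj₂ h) = inj₂ (Sat-mono I⊆J ψ h)
Sat-mono I⊆J (and φ ψ) (h₁ , h₂) = Sat-mono I⊆J φ h₁ , Sat-mono I⊆J ψ h₂
Sat-mono I⊆J (ex φ) (s , h) = s , Sat-mono I⊆J φ h
Sat-mono I⊆J (all φ) h = λ s → Sat-mono I⊆J φ (h s)

Models-exN : {I : Interp k S} (m : ℕ) (φ : Fm k m) → Models S I (exN m φ) ⇔ ∃ (Sat S I φ)
Models-exN zero φ = mk⇔ (_ ,_) (λ (ρ , h) → Sat-resp-≗ φ (λ ()) h)
Models-exN (suc m) φ = ⇔.trans (Models-exN m (ex φ)) (mk⇔
  (λ (ρ , s , h) → extend s ρ , Sat-resp-≗ φ (λ { zero → refl ; (suc i) → refl }) h)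
  (λ (ρ , h) → ρ ∘ suc , ρ zero , Sat-resp-≗ φ (λ { zero → refl ; (suc i) → refl }) h))

⋁-map-⇔ : {A : Set} {I : Interp k S} {J : Interp k S'} {ρ : Fin n → S} {ρ' : Fin m → S'}
          {g : A → Fm k n} {h : A → Fm k m} →
          (∀ a → Sat S I (g a) ρ ⇔ Sat S' J (h a) ρ') →
          (as : List A) → Sat S I (⋁ (map g as)) ρ ⇔ Sat S' J (⋁ (map h as)) ρ'
⋁-map-⇔ g⇔h [] = mk⇔ id id
⋁-map-⇔ g⇔h (a ∷ as) = g⇔h a ⊎-⇔ ⋁-map-⇔ g⇔h as

Sat-dual⇒¬Sat-∁ : {I : Interp k S} (φ : Fm k n) {ρ : Fin n → S} →
                  Sat S I (dual φ) ρ → ¬ Sat S (∁ᴵ I) φ ρ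
Sat-dual⇒¬Sat-∁ tt () _
Sat-dual⇒¬Sat-∁ (atom q x) h ¬h = ¬h h
Sat-dual⇒¬Sat-∁ (eq x y) h e = h e
Sat-dual⇒¬Sat-∁ (neq x y) h ne = ne h
Sat-dual⇒¬Sat-∁ (or φ ψ) (d₁ , d₂) (inj₁ h) = Sat-dual⇒¬Sat-∁ φ d₁ h
Sat-dual⇒¬Sat-∁ (or φ ψ) (d₁ , d₂) (inj₂ h) = Sat-dual⇒¬Sat-∁ ψ d₂ h
Sat-dual⇒¬Sat-∁ (and φ ψ) (inj₁ d) (h₁ , h₂) = Sat-dual⇒¬Sat-∁ φ d h₁
Sat-dual⇒¬Sat-∁ (and φ ψ) (inj₂ d) (h₁ , h₂) = Sat-dual⇒¬Sat-∁ ψ d h₂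
Sat-dual⇒¬Sat-∁ (ex φ) d (s , h) =
  Sat-dual⇒¬Sat-∁ φ (d s) (Sat-resp-≗ φ (λ { zero → refl ; (suc i) → refl }) h)
Sat-dual⇒¬Sat-∁ (all φ) (s , d) h =
  Sat-dual⇒¬Sat-∁ φ d (Sat-resp-≗ φ (λ { zero → refl ; (suc i) → refl }) (h s))

module _ (em : ExcludedMiddle 0ℓ) {I : Interp k S} where

  Sat-dual⊎Sat-∁ : (φ : Fm k n) (ρ : Fin n → S) → Sat S I (dual φ) ρ ⊎ Sat S (∁ᴵ I) φ ρ
  Sat-dual⊎Sat-∁ tt ρ = inj₂ _
  Sat-dual⊎Sat-∁ ff ρ = inj₁ _
  Sat-dual⊎Sat-∁ (atom q x) ρ with em {I (ρ x) q}
  ... | yes h = inj₁ h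
  ... | no ¬h = inj₂ ¬h
  Sat-dual⊎Sat-∁ (eq x y) ρ with em {ρ x ≡ ρ y}
  ... | yes e = inj₂ e
  ... | no ne = inj₁ ne
  Sat-dual⊎Sat-∁ (neq x y) ρ with em {ρ x ≡ ρ y}
  ... | yes e = inj₁ e
  ... | no ne = inj₂ ne
  Sat-dual⊎Sat-∁ (or φ ψ) ρ with Sat-dual⊎Sat-∁ φ ρ | Sat-dual⊎Sat-∁ ψ ρ
  ... | inj₁ d₁ | inj₁ d₂ = inj₁ (d₁ , d₂)
  ... | inj₂ h  | _       = inj₂ (inj₁ h)
  ... | _       | inj₂ h  = inj₂ (inj₂ h)
  Sat-dual⊎Sat-∁ (and φ ψ) ρ with Sat-dual⊎Sat-∁ φ ρ | Sat-dual⊎Sat-∁ ψ ρ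
  ... | inj₂ h₁ | inj₂ h₂ = inj₂ (h₁ , h₂)
  ... | inj₁ d  | _       = inj₁ (inj₁ d)
  ... | _       | inj₁ d  = inj₁ (inj₂ d)
  Sat-dual⊎Sat-∁ (ex φ) ρ with em {Σ S λ s → Sat S (∁ᴵ I) φ (extend s ρ)}
  ... | yes (s , h) = inj₂ (s , Sat-resp-≗ φ (λ { zero → refl ; (suc i) → refl }) h)
  ... | no ¬h = inj₁ λ s →
    [ Sat-resp-≗ (dual φ) (λ { zero → refl ; (suc i) → refl }) , (λ h → ⊥-elim (¬h (s , h))) ]
      (Sat-dual⊎Sat-∁ φ (extend s ρ))
  Sat-dual⊎Sat-∁ (all φ) ρ with em {Σ S λ s → Sat S I (dual φ) (extend s ρ)}
  ... | yes (s , d) = inj₁ (s , Sat-resp-≗ (dual φ) (λ { zero → refl ; (suc i) → refl }) d)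
  ... | no ¬d = inj₂ λ s →
    [ (λ d → ⊥-elim (¬d (s , d))) , Sat-resp-≗ φ (λ { zero → refl ; (suc i) → refl }) ]
      (Sat-dual⊎Sat-∁ φ (extend s ρ))

  Sat-dual⇔¬Sat-∁ : (φ : Fm k n) {ρ : Fin n → S} → Sat S I (dual φ) ρ ⇔ (¬ Sat S (∁ᴵ I) φ ρ)
  Sat-dual⇔¬Sat-∁ φ {ρ} =
    mk⇔ (Sat-dual⇒¬Sat-∁ φ) (λ ¬h → [ id , ⊥-elim ∘ ¬h ] (Sat-dual⊎Sat-∁ φ ρ))

data SymmetricQF {k n : ℕ} : Fm k n → Set where
  tt   : SymmetricQF tt
  ff   : SymmetricQF ff
  atom : ∀ q x → SymmetricQF (atom q x)
  or   : ∀ {φ ψ} → SymmetricQF φ → SymmetricQF ψ → SymmetricQF (or φ ψ)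
  and  : ∀ {φ ψ} → SymmetricQF φ → SymmetricQF ψ → SymmetricQF (and φ ψ)

Sat-pullback : (f : S' → S) (I : Interp k S) {φ : Fm k n} → SymmetricQF φ → (ρ : Fin n → S') →
               Sat S' (pullback f I) φ ρ ⇔ Sat S I φ (f ∘ ρ)
Sat-pullback f I tt ρ = ⇔.refl
Sat-pullback f I ff ρ = ⇔.refl
Sat-pullback f I (atom q x) ρ = ⇔.refl
Sat-pullback f I (or p q) ρ = Sat-pullback f I p ρ ⊎-⇔ Sat-pullback f I q ρ
Sat-pullback f I (and p q) ρ = Sat-pullback f I p ρ ×-⇔ Sat-pullback f I q ρ

tyAux-symmetric : (emb : Fin m → Fin k) (A : Vec Bool m) (x : Fin n) → SymmetricQF (tyAux emb A x)
tyAux-symmetric emb [] x = tt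
tyAux-symmetric emb (true ∷ A) x = and (atom (emb zero) x) (tyAux-symmetric (emb ∘ suc) A x)
tyAux-symmetric emb (false ∷ A) x = tyAux-symmetric (emb ∘ suc) A x

⋀-symmetric : {φs : List (Fm k n)} → All SymmetricQF φs → SymmetricQF (⋀ φs)
⋀-symmetric [] = tt
⋀-symmetric (p ∷ ps) = and p (⋀-symmetric ps)

⋁-symmetric : {φs : List (Fm k n)} → All SymmetricQF φs → SymmetricQF (⋁ φs)
⋁-symmetric [] = ff
⋁-symmetric (p ∷ ps) = or p (⋁-symmetric ps)

typesOf-symmetric : (Te : List (QType k)) → SymmetricQF (typesOf Te)
typesOf-symmetric Te = ⋀-symmetric (All.map⁺ (All.tabulate⁺ λ i → tyAux-symmetric id (lookup Te i) i))

forallTypes-symmetric : (Ta : List (QType k)) → SymmetricQF (forallTypes {n = n} Ta)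
forallTypes-symmetric Ta = ⋁-symmetric (All.map⁺ (All.universal (λ B → tyAux-symmetric id B zero) Ta))

module _ {I : Interp k S} {σ : Fin n → S} where

  Sat-⋀ : (φs : List (Fm k n)) → Sat S I (⋀ φs) σ ⇔ All (λ φ → Sat S I φ σ) φs
  Sat-⋀ [] = mk⇔ (λ _ → []) (λ _ → _)
  Sat-⋀ (φ ∷ φs) = mk⇔ (λ (h , hs) → h ∷ to (Sat-⋀ φs) hs) (λ { (h ∷ hs) → h , from (Sat-⋀ φs) hs })

  Sat-diff : (vs : List (Fin n)) → Sat S I (diff vs) σ ⇔ AllPairs (_≢_ on σ) vs
  Sat-diff [] = mk⇔ (λ _ → []) (λ _ → _)
  Sat-diff (v ∷ vs) = mk⇔
    (λ (d , ds) → All.map⁻ (to (Sat-⋀ (map (neq v) vs)) d) ∷ to (Sat-diff vs) ds)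
    (λ { (d ∷ ds) → from (Sat-⋀ (map (neq v) vs)) (All.map⁺ d) , from (Sat-diff vs) ds })

extend-injective : {ρ : Fin n → S} {s : S} → Injective _≡_ _≡_ ρ → (∀ i → ρ i ≢ s) →
                   Injective _≡_ _≡_ (extend s ρ)
extend-injective inj fresh {zero}  {zero}  _ = refl
extend-injective inj fresh {zero}  {suc j} e = ⊥-elim (fresh j (sym e))
extend-injective inj fresh {suc i} {zero}  e = ⊥-elim (fresh i e)
extend-injective inj fresh {suc i} {suc j} e = cong suc (inj e)

extend-distinct : {ρ : Fin n → S} {s : S} → AllPairs (_≢_ on ρ) (allFin n) → (∀ i → ρ i ≢ s) →
                  AllPairs (_≢_ on extend s ρ) (map suc (allFin n) ++ zero ∷ [])
extend-distinct distinct fresh =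
  AllPairs.++⁺ (AllPairs.map⁺ distinct) ([] ∷ []) (All.map⁺ (All.tabulate⁺ λ i → fresh i ∷ []))

index-∈-lookup : (xs : List X) (i : Fin (length xs)) → index (∈-lookup {xs = xs} i) ≡ i
index-∈-lookup (x ∷ xs) zero = refl
index-∈-lookup (x ∷ xs) (suc i) = cong suc (index-∈-lookup xs i)

enumerable⇒finite : DecidableEquality X → (xs : List X) → (∀ x → x ∈ xs) → Finite X
enumerable⇒finite _≟_ xs _∈xs =
  length ys , mk↔ₛ′ (index ∘ _∈ys) (lookup ys) index∘lookup (λ x → sym (lookup-index (x ∈ys)))
  where
  ys : List _
  ys = deduplicate _≟_ xs
  _∈ys : ∀ x → x ∈ ys
  x ∈ys = ∈-deduplicate⁺ _≟_ (x ∈xs)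
  index∘lookup : ∀ i → index (lookup ys i ∈ys) ≡ i
  index∘lookup i =
    trans (cong index (unique⇒irrelevant (deduplicate-! _≟_ xs) _ (∈-lookup i))) (index-∈-lookup ys i)

module _ (em : ExcludedMiddle 0ℓ) {f : S' → S} where

  fibreElements : (s : S) → List S' → List (Fibre f s)
  fibreElements s [] = []
  fibreElements s (y ∷ ys) with em {f y ≡ s}
  ... | yes p = (y , p) ∷ fibreElements s ys
  ... | no _  = fibreElements s ys

  ∈-fibreElements : {s : S} {y : S'} {ys : List S'} (p : f y ≡ s) → y ∈ ys → (y , p) ∈ fibreElements s ys
  ∈-fibreElements {s} {ys = y ∷ ys} p (here refl) with em {f y ≡ s}
  ... | yes p' = here (cong (y ,_) (≡-irrelevant p p'))
  ... | no ¬p  = ⊥-elim (¬p p)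
  ∈-fibreElements {s} {ys = y' ∷ ys} p (there y∈ys) with em {f y' ≡ s}
  ... | yes _ = there (∈-fibreElements p y∈ys)
  ... | no _  = ∈-fibreElements p y∈ys

  fresh-in-fibre : {s : S} → Infinite (Fibre f s) → (σ : Fin m → S') →
                   ∃ λ y → f y ≡ s × (∀ i → σ i ≢ y)
  fresh-in-fibre {s = s} inf σ with em {∃ λ y → f y ≡ s × (∀ i → σ i ≢ y)}
  ... | yes fresh = fresh
  ... | no ¬fresh = ⊥-elim (inf (enumerable⇒finite (λ _ _ → em) (fibreElements s (tabulate σ)) covered))
    where
    covered : ∀ e → e ∈ fibreElements s (tabulate σ)
    covered (y , p) = ∈-fibreElements p (em⇒dne em λ y∉ →
      ¬fresh (y , p , λ i σi≡y → y∉ (subst (_∈ tabulate σ) σi≡y (∈-tabulate⁺ i))))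

  injective-lift : (∀ s → Infinite (Fibre f s)) → (ρ : Fin n → S) →
                   ∃ λ (ρ' : Fin n → S') → f ∘ ρ' ≗ ρ × Injective _≡_ _≡_ ρ'
  injective-lift {n = zero} inf ρ = (λ ()) , (λ ()) , λ { {()} }
  injective-lift {n = suc n} inf ρ =
    let ρ' , fρ'≗ρ , inj = injective-lift inf (ρ ∘ suc)
        y , fy≡ρ₀ , fresh = fresh-in-fibre (inf (ρ zero)) ρ'
    in extend y ρ' , (λ { zero → fy≡ρ₀ ; (suc i) → fρ'≗ρ i }) , extend-injective inj fresh

module _ (em : ExcludedMiddle 0ℓ) {f : S' → S} (inf : ∀ s → Infinite (Fibre f s)) (I : Interp k S) where

  basicSym⇒basicEq : (Te Ta : List (QType k)) →
                     Models S I (basicSym Te Ta) → Models S' (pullback f I) (basicEq Te Ta)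
  basicSym⇒basicEq Te Ta h with ρ , types , covered ← to (Models-exN (length Te) _) h =
    let ρ' , fρ'≗ρ , inj = injective-lift em inf ρ in
    from (Models-exN (length Te) _)
      ( ρ'
      , from (Sat-diff (xs Te)) (AllPairs.map (λ i≢j → i≢j ∘ inj) (allFin⁺ (length Te)))
      , from (Sat-pullback f I (typesOf-symmetric Te) ρ') (Sat-resp-≗ (typesOf Te) (sym ∘ fρ'≗ρ) types)
      , λ y → inj₂ (from (Sat-pullback f I (forallTypes-symmetric Ta) _)
                (Sat-resp-≗ (forallTypes Ta) (λ { zero → refl ; (suc i) → sym (fρ'≗ρ i) }) (covered (f y)))))

  basicEq⇒basicSym : (Te Ta : List (QType k)) →
                     Models S' (pullback f I) (basicEq Te Ta) → Models S I (basicSym Te Ta)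
  basicEq⇒basicSym Te Ta h with ρ' , distinct , types , covered ← to (Models-exN (length Te) _) h =
    from (Models-exN (length Te) _)
      ( f ∘ ρ'
      , to (Sat-pullback f I (typesOf-symmetric Te) ρ') types
      , λ y → Sat-resp-≗ (forallTypes Ta) (λ { zero → refl ; (suc i) → refl }) (covered-below y))
    where
    xs-y : List (Fin (suc (length Te)))
    xs-y = map suc (xs Te) ++ zero ∷ []
    covered-below : (y : S) → Sat S I (forallTypes Ta) (extend y (f ∘ ρ'))
    covered-below y with y' , fy'≡y , fresh ← fresh-in-fibre em (inf y) ρ'
      with covered y'
    ... | inj₁ not-distinct = ⊥-elim (Sat-dual⇒¬Sat-∁ (diff xs-y)
            (Sat-resp-≗ (dual (diff xs-y)) (λ { zero → refl ; (suc i) → refl }) not-distinct)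
            (from (Sat-diff xs-y) (extend-distinct (to (Sat-diff (xs Te)) distinct) fresh)))
    ... | inj₂ h = Sat-resp-≗ (forallTypes Ta) (λ { zero → fy'≡y ; (suc i) → refl })
            (to (Sat-pullback f I (forallTypes-symmetric Ta) _) h)

  basicSym⇔basicEq : (Te Ta : List (QType k)) →
                     Models S I (basicSym Te Ta) ⇔ Models S' (pullback f I) (basicEq Te Ta)
  basicSym⇔basicEq Te Ta = mk⇔ (basicSym⇒basicEq Te Ta) (basicEq⇒basicSym Te Ta)

lemma31 : ExcludedMiddle 0ℓ →
          (k : ℕ) (S S' : Set) → S → S' → (f : S' → S) →
          Surjective f → ((s : S) → Infinite (Fibre f s)) →
          (θ : Sentence k) (N : NormalForm θ) →
          ((I : Interp k S) → Models S I (BI N) ⇔ Models S' (pullback f I) θ)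
          × ((I : Interp k S) → Models S I (dual (BI N)) ⇔ Models S' (pullback f I) (dual θ))
          × ((I' : Interp k S') → Models S' I' θ → Models S (pushforward f I') (BI N))
          × ((I' : Interp k S') → Models S' I' (dual θ) → Models S (pushforward f I') (dual (BI N)))
lemma31 em k S S' _ s' f _ inf θ N = BI⇔θ , dual-BI⇔dual-θ , BI-pushforward , dual-BI-pushforward
  where
  open NormalForm N

  BI⇔θ : (I : Interp k S) → Models S I (BI N) ⇔ Models S' (pullback f I) θ
  BI⇔θ I = ⇔.trans (⋁-map-⇔ (λ (Te , Ta) → basicSym⇔basicEq em inf I Te Ta) disjuncts)
                    (⇔.sym (equivalence S' s' (pullback f I)))

  dual-BI⇔dual-θ : (I : Interp k S) → Models S I (dual (BI N)) ⇔ Models S' (pullback f I) (dual θ)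
  dual-BI⇔dual-θ I = ⇔.trans (Sat-dual⇔¬Sat-∁ em (BI N))
                       (⇔.trans (¬-cong-⇔ (BI⇔θ (∁ᴵ I))) (⇔.sym (Sat-dual⇔¬Sat-∁ em θ)))

  BI-pushforward : (I' : Interp k S') → Models S' I' θ → Models S (pushforward f I') (BI N)
  BI-pushforward I' = from (BI⇔θ (pushforward f I')) ∘ Sat-mono (λ y q∈I'y → y , refl , q∈I'y) θ

  dual-BI-pushforward : (I' : Interp k S') → Models S' I' (dual θ) → Models S (pushforward f I') (dual (BI N))
  dual-BI-pushforward I' h = from (Sat-dual⇔¬Sat-∁ em (BI N)) λ h∁ →
    Sat-dual⇒¬Sat-∁ θ h (Sat-mono (λ y q∉pushforward q∈I'y → q∉pushforward (y , refl , q∈I'y)) θ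
                          (to (BI⇔θ (∁ᴵ (pushforward f I'))) h∁))
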